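{- Let $n$ be an odd positive integer such that $B(n^2)\ge 2B(n)+1$, where $B(x)$ denotes the number of ones in the binary expansion of $x$. Then there exist natural numbers $\nu$ and $h$ such that $n'=n2^\nu-(2^h-1)$ satisfies $$B(n'^2)=2B(n')-1.$$
   Context: For a positive integer $x$, $B(x)$ denotes the sum of the binary digits of $x$ (its Hamming weight). -}

module Defs where

open import Data.Nat using (ℕ; zero; suc; _+_; _*_; _%_; _/_)

-- Number of ones in the binary expansion of x, computed with fuel
-- (fuel ≥ number of bits suffices; we use fuel = x).
B-aux : ℕ → ℕ → ℕ
B-aux zero    x = 0
B-aux (suc k) zero = 0
B-aux (suc k) x@(suc _) = x % 2 + B-aux k (x / 2)

B : ℕ → ℕ
B x = B-aux x x

{-# OPTIONS --safe #-}
module Submission where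

-- Write n = 1 + 2q, let c = B(n²) − 2B(n) ≥ 1, take h = n (any h with n < 2^h works)
-- and ν = c + 2h. In binary, n′ = n·2^ν − (2^h − 1) is n − 1 followed by ν − h ones,
-- h − 1 zeros and a one, so B(n′) = B(n) + ν − h. Its square is
-- (2r·2^ν + w)·2^ν + (2^h − 1)², where n² = 1 + 2r and w = 2^ν − 2n(2^h − 1): three
-- non-overlapping blocks. The middle one is the complement, within ν bits, of
-- 2n(2^h − 1) − 1, which has weight h, and (2^h − 1)² = (2^(h−1) − 1)·2^(h+1) + 1 also
-- has weight h. Hence B(n′²) = B(n²) − 1 + ν, and ν = c + 2h makes this 2B(n′) − 1.

open import Defs
open import Data.Nat using (ℕ; zero; suc; _+_; _*_; _∸_; _^_; _≤_; _<_; _%_; _/_; z≤n; s≤s; z<s)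
open import Data.Nat.Divisibility using (_∤_; divides; divides-refl)
open import Data.Nat.DivMod using (m/n<m; [m+kn]%n≡m%n; m*n/n≡m; +-distrib-/-∣ʳ)
open import Data.Nat.Properties
open import Data.Nat.Tactic.RingSolver using (solve-∀)
open import Data.Product using (∃-syntax; _×_; _,_)
open import Data.Empty using (⊥-elim)
open import Relation.Binary.PropositionalEquality
open import Function using (_∘_)

suc-/2≤pred : ∀ y → suc y / 2 ≤ y
suc-/2≤pred y = <⇒≤pred (m/n<m (suc y) 2 (s≤s (s≤s z≤n)))

B-aux-fuel : ∀ k k′ x → x ≤ k → x ≤ k′ → B-aux k x ≡ B-aux k′ x
B-aux-fuel zero    zero     zero _ _ = refl
B-aux-fuel zero    (suc k′) zero _ _ = refl
B-aux-fuel (suc k) zero     zero _ _ = refl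
B-aux-fuel (suc k) (suc k′) zero _ _ = refl
B-aux-fuel (suc k) (suc k′) x@(suc y) (s≤s y≤k) (s≤s y≤k′) =
  cong (x % 2 +_) (B-aux-fuel k k′ (x / 2) (≤-trans (suc-/2≤pred y) y≤k) (≤-trans (suc-/2≤pred y) y≤k′))

B-unfold : ∀ x → B x ≡ x % 2 + B (x / 2)
B-unfold zero      = refl
B-unfold x@(suc y) = cong (x % 2 +_) (B-aux-fuel y (x / 2) (x / 2) (suc-/2≤pred y) ≤-refl)

B-double : ∀ a → B (2 * a) ≡ B a
B-double a = begin
  B (2 * a)                    ≡⟨ cong B (*-comm 2 a) ⟩
  B (a * 2)                    ≡⟨ B-unfold (a * 2) ⟩
  a * 2 % 2 + B (a * 2 / 2)    ≡⟨ cong₂ _+_ ([m+kn]%n≡m%n 0 a 2) (cong B (m*n/n≡m a 2)) ⟩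
  B a                          ∎
  where open ≡-Reasoning

B-double-suc : ∀ a → B (1 + 2 * a) ≡ suc (B a)
B-double-suc a = begin
  B (1 + 2 * a)                          ≡⟨ cong (λ t → B (1 + t)) (*-comm 2 a) ⟩
  B (1 + a * 2)                          ≡⟨ B-unfold (1 + a * 2) ⟩
  (1 + a * 2) % 2 + B ((1 + a * 2) / 2)  ≡⟨ cong₂ _+_ ([m+kn]%n≡m%n 1 a 2) (cong B half) ⟩
  suc (B a)                              ∎
  where
  open ≡-Reasoning
  half : (1 + a * 2) / 2 ≡ a
  half = trans (+-distrib-/-∣ʳ 1 {d = 2} (divides-refl a)) (m*n/n≡m a 2)

data Parity : ℕ → Set where
  even : ∀ a → Parity (2 * a)
  odd  : ∀ a → Parity (1 + 2 * a)

parity : ∀ m → Parity m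
parity zero          = even 0
parity (suc zero)    = odd 0
parity (suc (suc m)) with parity m
... | even a = subst Parity (cong suc (+-suc a (a + 0))) (even (suc a))
... | odd a  = subst Parity (cong (suc ∘ suc) (+-suc a (a + 0))) (odd (suc a))

n<2^n : ∀ n → n < 2 ^ n
n<2^n zero    = z<s
n<2^n (suc n) = begin-strict
  suc n           ≡⟨ +-comm 1 n ⟩
  n + 1           <⟨ +-mono-<-≤ (n<2^n n) (m^n>0 2 n) ⟩
  2 ^ n + 2 ^ n   ≡⟨ cong (2 ^ n +_) (+-identityʳ (2 ^ n)) ⟨
  2 ^ suc n       ∎
  where open ≤-Reasoning

square-of-difference : ∀ m e {x} → m + e ≡ x → m * m + 2 * e * x ≡ x * x + e * e
square-of-difference m e refl = expand m e
  where
  expand : ∀ m e → m * m + 2 * e * (m + e) ≡ (m + e) * (m + e) + e * e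
  expand = solve-∀

-- (nV − e)² = (n²V − 2ne)·V + e², verified after adding 2e·nV to both sides so that no
-- subtraction occurs.
square-digits : ∀ n r V e {m w} → n * n ≡ 1 + 2 * r → m + e ≡ n * V → 2 * n * e + w ≡ V →
                m * m ≡ (2 * r * V + w) * V + e * e
square-digits n r V e {m} {w} n²≡1+2r m+e≡nV 2ne+w≡V = +-cancelʳ-≡ (2 * e * (n * V)) _ _ (begin
  m * m + 2 * e * (n * V)                    ≡⟨ square-of-difference m e m+e≡nV ⟩
  n * V * (n * V) + e * e                    ≡⟨ interchange n V (e * e) ⟩
  n * n * V * V + e * e                      ≡⟨ cong (λ t → t * V * V + e * e) n²≡1+2r ⟩
  (1 + 2 * r) * V * V + e * e                ≡⟨ split-odd r V (e * e) ⟩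
  (2 * r * V + V) * V + e * e                ≡⟨ cong (λ t → (2 * r * V + t) * V + e * e) 2ne+w≡V ⟨
  (2 * r * V + (2 * n * e + w)) * V + e * e  ≡⟨ collect r V n e w ⟩
  (2 * r * V + w) * V + e * e + 2 * e * (n * V)  ∎)
  where
  open ≡-Reasoning
  interchange : ∀ n V x → n * V * (n * V) + x ≡ n * n * V * V + x
  interchange = solve-∀
  split-odd : ∀ r V x → (1 + 2 * r) * V * V + x ≡ (2 * r * V + V) * V + x
  split-odd = solve-∀
  collect : ∀ r V n e w → (2 * r * V + (2 * n * e + w)) * V + e * e
                          ≡ (2 * r * V + w) * V + e * e + 2 * e * (n * V)
  collect = solve-∀

positive-exponent : ∀ {m h} → suc m < 2 ^ h → 0 < h
positive-exponent {h = zero}  (s≤s ())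
positive-exponent {h = suc _} _ = z<s

B-*2^+ : ∀ k a b → b < 2 ^ k → B (a * 2 ^ k + b) ≡ B a + B b
B-*2^+ zero    a zero    _ =
  trans (cong B (trans (+-identityʳ (a * 1)) (*-identityʳ a))) (sym (+-identityʳ (B a)))
B-*2^+ zero    a (suc b) (s≤s ())
B-*2^+ (suc k) a b b<2^1+k with parity b
... | even b′ = begin
  B (a * (2 * 2 ^ k) + 2 * b′) ≡⟨ cong B (regroup a (2 ^ k) b′) ⟩
  B (2 * (a * 2 ^ k + b′))     ≡⟨ B-double (a * 2 ^ k + b′) ⟩
  B (a * 2 ^ k + b′)           ≡⟨ B-*2^+ k a b′ (*-cancelˡ-< 2 b′ (2 ^ k) b<2^1+k) ⟩
  B a + B b′                   ≡⟨ cong (B a +_) (B-double b′) ⟨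
  B a + B (2 * b′)             ∎
  where
  open ≡-Reasoning
  regroup : ∀ a p b → a * (2 * p) + 2 * b ≡ 2 * (a * p + b)
  regroup = solve-∀
... | odd b′ = begin
  B (a * (2 * 2 ^ k) + (1 + 2 * b′)) ≡⟨ cong B (regroup a (2 ^ k) b′) ⟩
  B (1 + 2 * (a * 2 ^ k + b′))       ≡⟨ B-double-suc (a * 2 ^ k + b′) ⟩
  suc (B (a * 2 ^ k + b′))           ≡⟨ cong suc (B-*2^+ k a b′ (*-cancelˡ-< 2 b′ (2 ^ k) (<⇒≤ b<2^1+k))) ⟩
  suc (B a + B b′)                   ≡⟨ +-suc (B a) (B b′) ⟨
  B a + suc (B b′)                   ≡⟨ cong (B a +_) (B-double-suc b′) ⟨
  B a + B (1 + 2 * b′)               ∎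
  where
  open ≡-Reasoning
  regroup : ∀ a p b → a * (2 * p) + (1 + 2 * b) ≡ 1 + 2 * (a * p + b)
  regroup = solve-∀

B-complement : ∀ k a b → a + b + 1 ≡ 2 ^ k → B a + B b ≡ k
B-complement zero a b a+b+1≡1 = both-zero a b (+-cancelʳ-≡ 1 (a + b) 0 a+b+1≡1)
  where
  both-zero : ∀ a b → a + b ≡ 0 → B a + B b ≡ 0
  both-zero zero zero _ = refl
B-complement (suc k) a b a+b+1≡2^1+k with parity a | parity b
... | even a′ | even b′ = ⊥-elim (even≢odd (2 ^ k) (a′ + b′) (trans (sym a+b+1≡2^1+k) (regroup a′ b′)))
  where
  regroup : ∀ a b → 2 * a + 2 * b + 1 ≡ 1 + 2 * (a + b)
  regroup = solve-∀
... | odd a′  | odd b′  = ⊥-elim (even≢odd (2 ^ k) (suc (a′ + b′)) (trans (sym a+b+1≡2^1+k) (regroup a′ b′)))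
  where
  regroup : ∀ a b → 1 + 2 * a + (1 + 2 * b) + 1 ≡ 1 + 2 * suc (a + b)
  regroup = solve-∀
... | even a′ | odd b′  = begin
  B (2 * a′) + B (1 + 2 * b′) ≡⟨ cong₂ _+_ (B-double a′) (B-double-suc b′) ⟩
  B a′ + suc (B b′)           ≡⟨ +-suc (B a′) (B b′) ⟩
  suc (B a′ + B b′)           ≡⟨ cong suc (B-complement k a′ b′ (*-cancelˡ-≡ _ _ 2 (trans (regroup a′ b′) a+b+1≡2^1+k))) ⟩
  suc k                       ∎
  where
  open ≡-Reasoning
  regroup : ∀ a b → 2 * (a + b + 1) ≡ 2 * a + (1 + 2 * b) + 1
  regroup = solve-∀
... | odd a′  | even b′ = begin
  B (1 + 2 * a′) + B (2 * b′) ≡⟨ cong₂ _+_ (B-double-suc a′) (B-double b′) ⟩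
  suc (B a′ + B b′)           ≡⟨ cong suc (B-complement k a′ b′ (*-cancelˡ-≡ _ _ 2 (trans (regroup a′ b′) a+b+1≡2^1+k))) ⟩
  suc k                       ∎
  where
  open ≡-Reasoning
  regroup : ∀ a b → 2 * (a + b + 1) ≡ 1 + 2 * a + 2 * b + 1
  regroup = solve-∀

ones : ℕ → ℕ
ones k = 2 ^ k ∸ 1

ones+1≡2^ : ∀ k → ones k + 1 ≡ 2 ^ k
ones+1≡2^ k = m∸n+n≡m (m^n>0 2 k)

ones<2^ : ∀ k → ones k < 2 ^ k
ones<2^ k = subst (ones k <_) (ones+1≡2^ k) (m<m+n (ones k) z<s)

B-ones : ∀ k → B (ones k) ≡ k
B-ones k = trans (sym (+-identityʳ (B (ones k))))
                 (B-complement k (ones k) 0 (trans (cong (_+ 1) (+-identityʳ (ones k))) (ones+1≡2^ k)))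

ones-suc : ∀ k → ones (suc k) ≡ 1 + 2 * ones k
ones-suc k = +-cancelʳ-≡ 1 _ _ (begin
  ones (suc k) + 1       ≡⟨ ones+1≡2^ (suc k) ⟩
  2 * 2 ^ k              ≡⟨ cong (2 *_) (ones+1≡2^ k) ⟨
  2 * (ones k + 1)       ≡⟨ regroup (ones k) ⟩
  1 + 2 * ones k + 1     ∎)
  where
  open ≡-Reasoning
  regroup : ∀ e → 2 * (e + 1) ≡ 1 + 2 * e + 1
  regroup = solve-∀

1<2^ : ∀ {h} → 0 < h → 1 < 2 ^ h
1<2^ 0<h = ^-monoʳ-< 2 (s≤s (s≤s z≤n)) 0<h

B-ones² : ∀ {h} → 0 < h → B (ones h * ones h) ≡ h
B-ones² {suc k} _ = begin
  B (ones (suc k) * ones (suc k))   ≡⟨ cong (λ t → B (t * t)) (ones-suc k) ⟩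
  B ((1 + 2 * e) * (1 + 2 * e))     ≡⟨ cong B square ⟩
  B (2 * e * 2 ^ suc k + 1)         ≡⟨ B-*2^+ (suc k) (2 * e) 1 (1<2^ {suc k} z<s) ⟩
  B (2 * e) + 1                     ≡⟨ cong (_+ 1) (trans (B-double e) (B-ones k)) ⟩
  k + 1                             ≡⟨ +-comm k 1 ⟩
  suc k                             ∎
  where
  open ≡-Reasoning
  e : ℕ
  e = ones k
  expand : ∀ e → (1 + 2 * e) * (1 + 2 * e) ≡ 2 * e * (2 * (e + 1)) + 1
  expand = solve-∀
  square : (1 + 2 * e) * (1 + 2 * e) ≡ 2 * e * 2 ^ suc k + 1
  square = trans (expand e) (cong (λ t → 2 * e * (2 * t) + 1) (ones+1≡2^ k))

ones≤*2^ : ∀ x j h → ones h ≤ suc x * 2 ^ (j + h)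
ones≤*2^ x j h = begin
  ones h              ≤⟨ <⇒≤ (ones<2^ h) ⟩
  2 ^ h               ≤⟨ ^-monoʳ-≤ 2 (m≤n+m h j) ⟩
  2 ^ (j + h)         ≤⟨ m≤n*m (2 ^ (j + h)) (suc x) ⟩
  suc x * 2 ^ (j + h) ∎
  where open ≤-Reasoning

B-*2^∸ones : ∀ x j h → 0 < h → B (suc x * 2 ^ (j + h) ∸ ones h) ≡ B x + j + 1
B-*2^∸ones x j h 0<h = begin
  B (suc x * V ∸ ones h)        ≡⟨ cong B digits ⟩
  B (x * V + (ones j * H + 1))  ≡⟨ B-*2^+ (j + h) x _ low<V ⟩
  B x + B (ones j * H + 1)      ≡⟨ cong (B x +_) (B-*2^+ h (ones j) 1 (1<2^ 0<h)) ⟩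
  B x + (B (ones j) + 1)        ≡⟨ cong (λ t → B x + (t + 1)) (B-ones j) ⟩
  B x + (j + 1)                 ≡⟨ +-assoc (B x) j 1 ⟨
  B x + j + 1                   ∎
  where
  open ≡-Reasoning
  H V : ℕ
  H = 2 ^ h
  V = 2 ^ (j + h)
  low+H≡V : ones j * H + H ≡ V
  low+H≡V = begin
    ones j * H + H    ≡⟨ factor (ones j) H ⟩
    (ones j + 1) * H  ≡⟨ cong (_* H) (ones+1≡2^ j) ⟩
    2 ^ j * H         ≡⟨ ^-distribˡ-+-* 2 j h ⟨
    V                 ∎
    where
    factor : ∀ e H → e * H + H ≡ (e + 1) * H
    factor = solve-∀
  low<V : ones j * H + 1 < V
  low<V = subst (ones j * H + 1 <_) low+H≡V (+-monoʳ-< (ones j * H) (1<2^ 0<h))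
  digits : suc x * V ∸ ones h ≡ x * V + (ones j * H + 1)
  digits = +-cancelʳ-≡ (ones h) _ _ (begin
    suc x * V ∸ ones h + ones h          ≡⟨ m∸n+n≡m (ones≤*2^ x j h) ⟩
    V + x * V                            ≡⟨ +-comm V (x * V) ⟩
    x * V + V                            ≡⟨ cong (x * V +_) low+H≡V ⟨
    x * V + (ones j * H + H)             ≡⟨ cong (λ t → x * V + (ones j * H + t)) (ones+1≡2^ h) ⟨
    x * V + (ones j * H + (ones h + 1))  ≡⟨ shuffle (x * V) (ones j * H) (ones h) ⟩
    x * V + (ones j * H + 1) + ones h    ∎)
    where
    shuffle : ∀ a b e → a + (b + (e + 1)) ≡ a + (b + 1) + e
    shuffle = solve-∀

B-complement-2n*ones : ∀ q h ν w → 1 + 2 * q < 2 ^ h →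
                       2 * (1 + 2 * q) * ones h + w ≡ 2 ^ ν → B w + h ≡ ν
B-complement-2n*ones q h ν w n<H 2ne+w≡2^ν = begin
  B w + h    ≡⟨ cong (B w +_) B-μ ⟨
  B w + B μ  ≡⟨ B-complement ν w μ w+μ+1≡2^ν ⟩
  ν          ∎
  where
  open ≡-Reasoning
  n H d μ : ℕ
  n = 1 + 2 * q
  H = 2 ^ h
  d = H ∸ suc n
  μ = 1 + 2 * (2 * q * H + d)
  1+n+d≡H : suc n + d ≡ H
  1+n+d≡H = m+[n∸m]≡n n<H
  d<H : d < H
  d<H = subst (d <_) 1+n+d≡H (m<n+m d z<s)
  B-μ : B μ ≡ h
  B-μ = begin
    B μ                      ≡⟨ B-double-suc (2 * q * H + d) ⟩
    suc (B (2 * q * H + d))  ≡⟨ cong suc (B-*2^+ h (2 * q) d d<H) ⟩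
    suc (B (2 * q) + B d)    ≡⟨ cong (λ t → suc (t + B d)) (B-double q) ⟩
    suc (B q + B d)          ≡⟨ cong (_+ B d) (B-double-suc q) ⟨
    B n + B d                ≡⟨ B-complement h n d (trans (+-comm (n + d) 1) 1+n+d≡H) ⟩
    h                        ∎
  μ+1≡2ne : μ + 1 ≡ 2 * n * ones h
  μ+1≡2ne = sym (+-cancelʳ-≡ (2 * n) _ _ (begin
    2 * n * ones h + 2 * n          ≡⟨ factor n (ones h) ⟩
    2 * n * (ones h + 1)            ≡⟨ cong (2 * n *_) (ones+1≡2^ h) ⟩
    2 * n * H                       ≡⟨ unfold-n q H ⟩
    2 * (H + 2 * q * H)             ≡⟨ cong (λ t → 2 * (t + 2 * q * H)) 1+n+d≡H ⟨
    2 * (suc n + d + 2 * q * H)     ≡⟨ collect q H d ⟩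
    μ + 1 + 2 * n                   ∎))
    where
    factor : ∀ n e → 2 * n * e + 2 * n ≡ 2 * n * (e + 1)
    factor = solve-∀
    unfold-n : ∀ q H → 2 * (1 + 2 * q) * H ≡ 2 * (H + 2 * q * H)
    unfold-n = solve-∀
    collect : ∀ q H d → 2 * (suc (1 + 2 * q) + d + 2 * q * H)
                        ≡ 1 + 2 * (2 * q * H + d) + 1 + 2 * (1 + 2 * q)
    collect = solve-∀
  w+μ+1≡2^ν : w + μ + 1 ≡ 2 ^ ν
  w+μ+1≡2^ν = begin
    w + μ + 1             ≡⟨ +-assoc w μ 1 ⟩
    w + (μ + 1)           ≡⟨ cong (w +_) μ+1≡2ne ⟩
    w + 2 * n * ones h    ≡⟨ +-comm w _ ⟩
    2 * n * ones h + w    ≡⟨ 2ne+w≡2^ν ⟩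
    2 ^ ν                 ∎

2n*ones≤2^ : ∀ {n} j h → 0 < j → n < 2 ^ h → 2 * n * ones h ≤ 2 ^ (j + h + h)
2n*ones≤2^ {n} j h 0<j n<2^h = begin
  2 * n * ones h         ≤⟨ *-mono-≤ (*-monoʳ-≤ 2 (<⇒≤ n<2^h)) (<⇒≤ (ones<2^ h)) ⟩
  2 * 2 ^ h * 2 ^ h      ≤⟨ *-monoˡ-≤ (2 ^ h) (*-monoˡ-≤ (2 ^ h) (^-monoʳ-≤ 2 0<j)) ⟩
  2 ^ j * 2 ^ h * 2 ^ h  ≡⟨ cong (_* 2 ^ h) (^-distribˡ-+-* 2 j h) ⟨
  2 ^ (j + h) * 2 ^ h    ≡⟨ ^-distribˡ-+-* 2 (j + h) h ⟨
  2 ^ (j + h + h)        ∎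
  where open ≤-Reasoning

ones²<2^ : ∀ j h → ones h * ones h < 2 ^ (j + h + h)
ones²<2^ j h = begin-strict
  ones h * ones h       <⟨ *-mono-< (ones<2^ h) (ones<2^ h) ⟩
  2 ^ h * 2 ^ h         ≤⟨ *-monoˡ-≤ (2 ^ h) (^-monoʳ-≤ 2 (m≤n+m h j)) ⟩
  2 ^ (j + h) * 2 ^ h   ≡⟨ ^-distribˡ-+-* 2 (j + h) h ⟨
  2 ^ (j + h + h)       ∎
  where open ≤-Reasoning

B-square-*2^∸ones : ∀ q j h → 0 < j → 1 + 2 * q < 2 ^ h →
  let n = 1 + 2 * q
      m = n * 2 ^ (j + h + h) ∸ ones h
  in B (m * m) + 1 ≡ B (n * n) + j + h + h
B-square-*2^∸ones q j h 0<j n<2^h = begin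
  B (m * m) + 1                        ≡⟨ cong (λ t → B t + 1) (square-digits n r V e n²≡1+2r m+e≡nV 2ne+w≡V) ⟩
  B ((2 * r * V + w) * V + e * e) + 1  ≡⟨ cong (_+ 1) (B-*2^+ ν (2 * r * V + w) (e * e) (ones²<2^ j h)) ⟩
  B (2 * r * V + w) + B (e * e) + 1    ≡⟨ cong₂ (λ a b → a + b + 1) (B-*2^+ ν (2 * r) w w<V) (B-ones² 0<h) ⟩
  B (2 * r) + B w + h + 1              ≡⟨ cong₂ (λ a b → a + b + h + 1) (B-double r) B-w ⟩
  B r + (j + h) + h + 1                ≡⟨ regroup (B r) j h ⟩
  suc (B r) + j + h + h                ≡⟨ cong (λ t → t + j + h + h) (B-double-suc r) ⟨
  B (1 + 2 * r) + j + h + h            ≡⟨ cong (λ t → B t + j + h + h) n²≡1+2r ⟨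
  B (n * n) + j + h + h                ∎
  where
  open ≡-Reasoning
  n ν V e m r w : ℕ
  n = 1 + 2 * q
  ν = j + h + h
  V = 2 ^ ν
  e = ones h
  m = n * V ∸ e
  r = 2 * q * q + 2 * q
  w = V ∸ 2 * n * e
  0<h : 0 < h
  0<h = positive-exponent n<2^h
  n²≡1+2r : n * n ≡ 1 + 2 * r
  n²≡1+2r = square-odd q
    where
    square-odd : ∀ q → (1 + 2 * q) * (1 + 2 * q) ≡ 1 + 2 * (2 * q * q + 2 * q)
    square-odd = solve-∀
  m+e≡nV : m + e ≡ n * V
  m+e≡nV = m∸n+n≡m (ones≤*2^ (2 * q) (j + h) h)
  2ne+w≡V : 2 * n * e + w ≡ V
  2ne+w≡V = m+[n∸m]≡n (2n*ones≤2^ j h 0<j n<2^h)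
  w<V : w < V
  w<V = subst (w <_) 2ne+w≡V (m<n+m w (≤-trans (m<n⇒0<n∸m (1<2^ 0<h)) (m≤n*m e (2 * n))))
  B-w : B w ≡ j + h
  B-w = +-cancelʳ-≡ h _ _ (B-complement-2n*ones q h ν w n<2^h 2ne+w≡V)
  regroup : ∀ b j h → b + (j + h) + h + 1 ≡ suc b + j + h + h
  regroup = solve-∀

lemma4 : (n : ℕ) → 0 < n → 2 ∤ n → 2 * B n + 1 ≤ B (n * n) →
    ∃[ ν ] ∃[ h ] (2 ^ h ∸ 1 ≤ n * 2 ^ ν) ×
      (let n′ = n * 2 ^ ν ∸ (2 ^ h ∸ 1) in B (n′ * n′) + 1 ≡ 2 * B n′)
lemma4 n _ 2∤n _ with parity n
lemma4 .(2 * a) _ 2∤n _ | even a = ⊥-elim (2∤n (divides a (*-comm 2 a)))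
lemma4 .(1 + 2 * q) _ _ 2Bn+1≤Bn² | odd q = c + n + n , n , ones≤*2^ (2 * q) (c + n) n , (begin
  B (n′ * n′) + 1                  ≡⟨ B-square-*2^∸ones q c n 0<c (n<2^n n) ⟩
  B (n * n) + c + n + n            ≡⟨ cong (λ t → t + c + n + n) 2Bn+c≡Bn² ⟨
  2 * B n + c + c + n + n          ≡⟨ cong (λ t → 2 * t + c + c + n + n) (B-double-suc q) ⟩
  2 * suc (B q) + c + c + n + n    ≡⟨ regroup (B q) c n ⟩
  2 * (B q + (c + n) + 1)          ≡⟨ cong (λ t → 2 * (t + (c + n) + 1)) (B-double q) ⟨
  2 * (B (2 * q) + (c + n) + 1)    ≡⟨ cong (2 *_) (B-*2^∸ones (2 * q) (c + n) n z<s) ⟨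
  2 * B n′                         ∎)
  where
  open ≡-Reasoning
  n c n′ : ℕ
  n = 1 + 2 * q
  c = B (n * n) ∸ 2 * B n
  n′ = n * 2 ^ (c + n + n) ∸ ones n
  2Bn+c≡Bn² : 2 * B n + c ≡ B (n * n)
  2Bn+c≡Bn² = m+[n∸m]≡n (≤-trans (m≤m+n (2 * B n) 1) 2Bn+1≤Bn²)
  0<c : 0 < c
  0<c = m<n⇒0<n∸m (subst (_≤ B (n * n)) (+-comm (2 * B n) 1) 2Bn+1≤Bn²)
  regroup : ∀ b c n → 2 * suc b + c + c + n + n ≡ 2 * (b + (c + n) + 1)
  regroup = solve-∀
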